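{- Let $G\neq K_n$ be a simple connected graph on $n\geq 2$ vertices. Then $\xi^{ac}(G)<\xi^{ac}(K_n)$.
   Context: $K_n$ is the complete graph on $n$ vertices. $\varepsilon(u)=\max_v d(u,v)$ is the eccentricity, $M(u)$ is the product of the degrees of all neighbors of $u$, and $\xi^{ac}(G)=\sum_{u\in V(G)}\frac{M(u)}{\varepsilon(u)}$ (defined for connected graphs with at least two vertices). -}

module Defs where

open import Data.Bool renaming (_≟_ to _≟B_) using (Bool; true; false; not; _∧_; _∨_; if_then_else_)
open import Data.Nat using (ℕ; zero; suc; _⊔_; _*_; _+_)
open import Data.Fin using (Fin; _≟_)
open import Data.List using (List; foldr; filter; length)
open import Data.List using (allFin)
open import Data.Integer using (+_)
open import Data.Rational using (ℚ; 0ℚ; _/_) renaming (_+_ to _+ℚ_)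
open import Data.Product using (∃)
open import Relation.Nullary.Decidable using (⌊_⌋)
open import Relation.Binary.PropositionalEquality using (_≡_; refl) renaming (sym to sym≡)
open import Relation.Nullary using (yes; no)
open import Data.Empty using (⊥-elim)

record SimpleGraph (n : ℕ) : Set where
  field
    adj    : Fin n → Fin n → Bool
    sym    : ∀ u v → adj u v ≡ adj v u
    irrefl : ∀ u → adj u u ≡ false
open SimpleGraph public

Kadj : ∀ {n} → Fin n → Fin n → Bool
Kadj u v = not ⌊ u ≟ v ⌋

data Walk {n : ℕ} (G : SimpleGraph n) : Fin n → Fin n → Set where
  here : ∀ {u} → Walk G u u
  step : ∀ {u w v} → adj G u w ≡ true → Walk G w v → Walk G u v

Connected : ∀ {n} → SimpleGraph n → Set
Connected G = ∀ u v → Walk G u v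

anyV : ∀ {n} → (Fin n → Bool) → Bool
anyV {n} p = foldr (λ i b → p i ∨ b) false (allFin n)

maxV : ∀ {n} → (Fin n → ℕ) → ℕ
maxV {n} f = foldr (λ i m → f i ⊔ m) 0 (allFin n)

sumℚ : ∀ {n} → (Fin n → ℚ) → ℚ
sumℚ {n} f = foldr (λ i q → f i +ℚ q) 0ℚ (allFin n)

reach : ∀ {n} → SimpleGraph n → ℕ → Fin n → Fin n → Bool
reach G zero    u v = ⌊ u ≟ v ⌋
reach G (suc k) u v = reach G k u v ∨ anyV (λ w → adj G u w ∧ reach G k w v)

search : (ℕ → Bool) → ℕ → ℕ → ℕ
search P k zero     = k
search P k (suc f)  = if P k then k else search P (suc k) f

-- Graph distance d(u,v): least k with a walk of length ≤ k from u to v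
-- (for connected G this is found within n steps).
dist : ∀ {n} → SimpleGraph n → Fin n → Fin n → ℕ
dist {n} G u v = search (λ k → reach G k u v) 0 n

ecc : ∀ {n} → SimpleGraph n → Fin n → ℕ
ecc G u = maxV (dist G u)

deg : ∀ {n} → SimpleGraph n → Fin n → ℕ
deg {n} G u = length (filter (λ w → adj G u w ≟B true) (allFin n))

M : ∀ {n} → SimpleGraph n → Fin n → ℕ
M {n} G u = foldr (λ w p → (if adj G u w then deg G w else 1) * p) 1 (allFin n)

-- m / d as a rational (d = 0 never occurs for connected graphs with n ≥ 2).
frac : ℕ → ℕ → ℚ
frac m zero    = 0ℚ
frac m (suc d) = (+ m) / suc d

ξac : ∀ {n} → SimpleGraph n → ℚ
ξac G = sumℚ (λ u → frac (M G u) (ecc G u))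

complete : (n : ℕ) → SimpleGraph n
complete n = record { adj = Kadj ; sym = Ksym ; irrefl = Kirr }
  where
  Ksym : ∀ u v → Kadj u v ≡ Kadj v u
  Ksym u v with u ≟ v | v ≟ u
  ... | yes _ | yes _ = refl
  ... | no _  | no _  = refl
  ... | yes p | no q  = ⊥-elim (q (sym≡ p))
  ... | no p  | yes q = ⊥-elim (p (sym≡ q))
  Kirr : ∀ u → Kadj u u ≡ false
  Kirr u with u ≟ u
  ... | yes _ = refl
  ... | no p  = ⊥-elim (p refl)

-- Termwise comparison with K_n. Neighbourhoods of G lie inside those of K_n
-- and degrees only grow, so M_G(u) ≤ M_K(u), while ε_K(u) = 1; hence every
-- term M(u)/ε(u) of ξ^{ac}(G) is at most the matching term of ξ^{ac}(K_n).
-- A vertex of eccentricity at most 1 is adjacent to all others, so as G ≠ K_n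
-- some vertex has ε_G(u) ≥ 2, and its term is at most M_K(u)/2 < M_K(u).
module Submission where

open import Defs
open import Data.Nat using (ℕ; _≥_)
open import Data.Fin using (Fin; _≟_)
open import Data.Bool using (Bool; not)
open import Data.Rational using (_<_)
open import Relation.Nullary using (¬_)
open import Relation.Binary.PropositionalEquality using (_≡_)

open import Data.Bool using (true; false; _∧_; _∨_; if_then_else_) renaming (_≟_ to _≟B_)
open import Data.Empty using (⊥-elim)
open import Data.Fin using (zero; punchIn)
open import Data.Fin.Properties using (punchInᵢ≢i; toℕ<n; all?; ¬∀⟶∃¬)
open import Data.Integer as ℤ using (+_; +≤+; +<+)
open import Data.Integer.Properties using (pos-*)
open import Data.List using (List; []; _∷_; foldr; allFin)
open import Data.List.Membership.Propositional using (_∈_; lose)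
open import Data.List.Membership.Propositional.Properties using (∈-allFin)
open import Data.List.Properties using (filter-some)
open import Data.List.Relation.Binary.Sublist.Heterogeneous.Properties using (length-mono-≤)
open import Data.List.Relation.Binary.Sublist.Propositional using (⊆-refl)
open import Data.List.Relation.Binary.Sublist.Propositional.Properties using (filter⁺)
open import Data.List.Relation.Unary.Any using (Any; here; there)
open import Data.Nat as ℕ using (zero; suc; z≤n; s≤s; _⊔_; _≤′_; ≤′-refl; ≤′-step)
import Data.Nat.Properties as ℕ
open import Data.Product using (∃; _×_; _,_)
open import Data.Rational using (ℚ; 0ℚ; _≤_; _/_) renaming (_+_ to _+ℚ_)
open import Data.Rational.Properties
  using (≤-refl; +-mono-≤; +-mono-<-≤; +-mono-≤-<; 0/n≡0; toℚᵘ-fromℚᵘ; toℚᵘ-cancel-≤; toℚᵘ-cancel-<)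
import Data.Rational.Unnormalised as ℚᵘ
import Data.Rational.Unnormalised.Properties as ℚᵘ
open import Data.Sum using (_⊎_; inj₁; inj₂)
open import Function using (_∘_)
open import Relation.Binary.PropositionalEquality
  using (refl; trans; cong; cong₂; subst; subst₂) renaming (sym to ≡-sym)
open import Relation.Nullary using (Dec; yes; no; contradiction)
open import Relation.Nullary.Decidable using (⌊_⌋; isYes≗does; dec-true; dec-false)

foldr-preserves : {A B : Set} (P : B → Set) {f : A → B → B} {e : B} →
                  (∀ x {y} → P y → P (f x y)) → P e → ∀ xs → P (foldr f e xs)
foldr-preserves P pres pe []       = pe
foldr-preserves P pres pe (x ∷ xs) = pres x (foldr-preserves P pres pe xs)

foldr-mono : {A B C : Set} (R : B → C → Set) {f : A → B → B} {g : A → C → C} {e : B} {e′ : C} →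
             (∀ x {y z} → R y z → R (f x y) (g x z)) → R e e′ →
             ∀ xs → R (foldr f e xs) (foldr g e′ xs)
foldr-mono R mono ree′ []       = ree′
foldr-mono R mono ree′ (x ∷ xs) = mono x (foldr-mono R mono ree′ xs)

∈⇒≤-foldr-⊔ : {A : Set} (f : A → ℕ) {i : A} {xs : List A} →
              i ∈ xs → f i ℕ.≤ foldr (λ j m → f j ⊔ m) 0 xs
∈⇒≤-foldr-⊔ f (here refl)            = ℕ.m≤m⊔n _ _
∈⇒≤-foldr-⊔ f {xs = x ∷ _} (there i∈) = ℕ.≤-trans (∈⇒≤-foldr-⊔ f i∈) (ℕ.m≤n⊔m (f x) _)

∨-trueˡ : ∀ {a} b → a ≡ true → a ∨ b ≡ true
∨-trueˡ b refl = refl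

∨-trueʳ : ∀ a {b} → b ≡ true → a ∨ b ≡ true
∨-trueʳ true  _ = refl
∨-trueʳ false b = b

∨-true-split : ∀ a {b} → a ∨ b ≡ true → a ≡ true ⊎ b ≡ true
∨-true-split true  _ = inj₁ refl
∨-true-split false b = inj₂ b

∧-true-split : ∀ a {b} → a ∧ b ≡ true → a ≡ true × b ≡ true
∧-true-split true {true} _ = refl , refl

foldr-∨-intro : {A : Set} (p : A → Bool) {i : A} {xs : List A} →
                i ∈ xs → p i ≡ true → foldr (λ j b → p j ∨ b) false xs ≡ true
foldr-∨-intro p (here refl)            pi = ∨-trueˡ _ pi
foldr-∨-intro p {xs = x ∷ _} (there i∈) pi = ∨-trueʳ (p x) (foldr-∨-intro p i∈ pi)

foldr-∨-elim : {A : Set} (p : A → Bool) (xs : List A) →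
               foldr (λ j b → p j ∨ b) false xs ≡ true → ∃ λ i → p i ≡ true
foldr-∨-elim p (x ∷ xs) any with ∨-true-split (p x) any
... | inj₁ px  = x , px
... | inj₂ any = foldr-∨-elim p xs any

⌊≟⌋⇒≡ : ∀ {n} {u v : Fin n} → ⌊ u ≟ v ⌋ ≡ true → u ≡ v
⌊≟⌋⇒≡ {u = u} {v} e with u ≟ v
... | yes u≡v = u≡v
⌊≟⌋⇒≡ () | no _

⌊≟⌋-refl : ∀ {n} (u : Fin n) → ⌊ u ≟ u ⌋ ≡ true
⌊≟⌋-refl u = trans (isYes≗does (u ≟ u)) (dec-true (u ≟ u) refl)

⌊≟⌋-≢ : ∀ {n} {u v : Fin n} → ¬ u ≡ v → ⌊ u ≟ v ⌋ ≡ false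
⌊≟⌋-≢ {u = u} {v} u≢v = trans (isYes≗does (u ≟ v)) (dec-false (u ≟ v) u≢v)

≢⇒Kadj : ∀ {n} {u v : Fin n} → ¬ u ≡ v → Kadj u v ≡ true
≢⇒Kadj u≢v = cong not (⌊≟⌋-≢ u≢v)

if-mono-≤ : ∀ {a b x y} → (a ≡ true → b ≡ true) → x ℕ.≤ y → 1 ℕ.≤ y →
            (if a then x else 1) ℕ.≤ (if b then y else 1)
if-mono-≤ {true}  {true}  a⇒b x≤y _   = x≤y
if-mono-≤ {true}  {false} a⇒b _   _   with a⇒b refl
... | ()
if-mono-≤ {false} {true}  _   _   1≤y = 1≤y
if-mono-≤ {false} {false} _   _   _   = ℕ.≤-refl

if-pos : ∀ b {y} → 1 ℕ.≤ y → 1 ℕ.≤ (if b then y else 1)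
if-pos true  1≤y = 1≤y
if-pos false _   = ℕ.≤-refl

search-≤ : ∀ P k f {j} → P j ≡ true → k ℕ.≤ j → j ℕ.< k ℕ.+ f → search P k f ℕ.≤ j
search-≤ P k zero    _  k≤j j<k+0 =
  ⊥-elim (ℕ.<⇒≱ j<k+0 (ℕ.≤-trans (ℕ.≤-reflexive (ℕ.+-identityʳ k)) k≤j))
search-≤ P k (suc f) {j} Pj k≤j j<k+f with P k in Pk | ℕ.m≤n⇒m<n∨m≡n k≤j
... | true  | _         = k≤j
... | false | inj₁ k<j  = search-≤ P (suc k) f {j} Pj k<j (subst (j ℕ.<_) (ℕ.+-suc k f) j<k+f)
... | false | inj₂ refl = contradiction (trans (≡-sym Pj) Pk) λ ()

search-hit : ∀ P k f → search P k f ℕ.< k ℕ.+ f → P (search P k f) ≡ true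
search-hit P k zero    s<k+0 = ⊥-elim (ℕ.<-irrefl (≡-sym (ℕ.+-identityʳ k)) s<k+0)
search-hit P k (suc f) s<k+f with P k in Pk
... | true  = Pk
... | false = search-hit P (suc k) f (subst (search P (suc k) f ℕ.<_) (ℕ.+-suc k f) s<k+f)

cross-multiply-≤ : ∀ a b d e → a ℕ.* suc e ℕ.≤ b ℕ.* suc d → (+ a) / suc d ≤ (+ b) / suc e
cross-multiply-≤ a b d e h = toℚᵘ-cancel-≤
  (ℚᵘ.≤-respˡ-≃ (ℚᵘ.≃-sym (toℚᵘ-fromℚᵘ (ℚᵘ.mkℚᵘ (+ a) d)))
    (ℚᵘ.≤-respʳ-≃ (ℚᵘ.≃-sym (toℚᵘ-fromℚᵘ (ℚᵘ.mkℚᵘ (+ b) e)))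
    (ℚᵘ.*≤* (subst₂ ℤ._≤_ (pos-* a (suc e)) (pos-* b (suc d)) (+≤+ h)))))

cross-multiply-< : ∀ a b d e → a ℕ.* suc e ℕ.< b ℕ.* suc d → (+ a) / suc d < (+ b) / suc e
cross-multiply-< a b d e h = toℚᵘ-cancel-<
  (ℚᵘ.<-respˡ-≃ (ℚᵘ.≃-sym (toℚᵘ-fromℚᵘ (ℚᵘ.mkℚᵘ (+ a) d)))
    (ℚᵘ.<-respʳ-≃ (ℚᵘ.≃-sym (toℚᵘ-fromℚᵘ (ℚᵘ.mkℚᵘ (+ b) e)))
    (ℚᵘ.*<* (subst₂ ℤ._<_ (pos-* a (suc e)) (pos-* b (suc d)) (+<+ h)))))

frac-≤-whole : ∀ {a b} e → a ℕ.≤ b → frac a e ≤ frac b 1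
frac-≤-whole {b = b} zero _ = subst (_≤ frac b 1) (0/n≡0 1) (cross-multiply-≤ 0 b 0 0 z≤n)
frac-≤-whole {a} {b} (suc d) a≤b = cross-multiply-≤ a b d 0 (ℕ.*-mono-≤ a≤b (s≤s z≤n))

frac-<-whole : ∀ {a b e} → a ℕ.≤ b → 1 ℕ.≤ b → 2 ℕ.≤ e → frac a e < frac b 1
frac-<-whole {a} {suc b} {suc (suc d)} a≤b (s≤s _) (s≤s (s≤s _)) =
  cross-multiply-< a (suc b) (suc d) 0
    (ℕ.≤-<-trans (ℕ.*-monoˡ-≤ 1 a≤b) (ℕ.*-monoʳ-< (suc b) (s≤s (s≤s z≤n))))

Σℚ : {A : Set} → List A → (A → ℚ) → ℚ
Σℚ xs f = foldr (λ i q → f i +ℚ q) 0ℚ xs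

Σℚ-mono-≤ : {A : Set} {f g : A → ℚ} → (∀ i → f i ≤ g i) → ∀ xs → Σℚ xs f ≤ Σℚ xs g
Σℚ-mono-≤ f≤g = foldr-mono _≤_ (λ i → +-mono-≤ (f≤g i)) ≤-refl

Σℚ-mono-< : {A : Set} {f g : A → ℚ} {xs : List A} →
            (∀ i → f i ≤ g i) → Any (λ i → f i < g i) xs → Σℚ xs f < Σℚ xs g
Σℚ-mono-< f≤g (here {xs = xs} f<g) = +-mono-<-≤ f<g (Σℚ-mono-≤ f≤g xs)
Σℚ-mono-< f≤g (there {x = x} any)  = +-mono-≤-< (f≤g x) (Σℚ-mono-< f≤g any)

module _ {n : ℕ} (G : SimpleGraph n) where

  adj⇒≢ : ∀ {u v} → adj G u v ≡ true → ¬ u ≡ v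
  adj⇒≢ {u} Guv refl = contradiction (trans (≡-sym Guv) (irrefl G u)) λ ()

  adj⇒Kadj : ∀ {u v} → adj G u v ≡ true → Kadj u v ≡ true
  adj⇒Kadj = ≢⇒Kadj ∘ adj⇒≢

  reach-mono : ∀ {k l u v} → k ≤′ l → reach G k u v ≡ true → reach G l u v ≡ true
  reach-mono ≤′-refl        r = r
  reach-mono (≤′-step k≤′l) r = ∨-trueˡ _ (reach-mono k≤′l r)

  adj⇒reach-1 : ∀ {u v} → adj G u v ≡ true → reach G 1 u v ≡ true
  adj⇒reach-1 {u} {v} Guv = ∨-trueʳ ⌊ u ≟ v ⌋
    (foldr-∨-intro (λ w → adj G u w ∧ ⌊ w ≟ v ⌋) (∈-allFin v) (cong₂ _∧_ Guv (⌊≟⌋-refl v)))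

  reach-1⇒≡⊎adj : ∀ {u v} → reach G 1 u v ≡ true → u ≡ v ⊎ adj G u v ≡ true
  reach-1⇒≡⊎adj {u} {v} r with ∨-true-split ⌊ u ≟ v ⌋ r
  ... | inj₁ u≡v = inj₁ (⌊≟⌋⇒≡ u≡v)
  ... | inj₂ any with foldr-∨-elim (λ w → adj G u w ∧ ⌊ w ≟ v ⌋) (allFin n) any
  ... | w , e with ∧-true-split (adj G u w) e
  ... | Guw , w≡v with ⌊≟⌋⇒≡ w≡v
  ... | refl = inj₂ Guw

  dist-≤ : ∀ {u v k} → reach G k u v ≡ true → k ℕ.< n → dist G u v ℕ.≤ k
  dist-≤ r k<n = search-≤ _ 0 n r z≤n k<n

  dist-reach : ∀ {u v} → dist G u v ℕ.< n → reach G (dist G u v) u v ≡ true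
  dist-reach = search-hit _ 0 n

  ≢⇒dist-pos : ∀ {u v} → ¬ u ≡ v → 1 ℕ.≤ dist G u v
  ≢⇒dist-pos {u} {v} u≢v with dist G u v | dist-reach {u} {v}
  ... | zero  | reach-at = contradiction (⌊≟⌋⇒≡ (reach-at (ℕ.≤-<-trans z≤n (toℕ<n u)))) u≢v
  ... | suc _ | _        = s≤s z≤n

  deg-≤-complete : ∀ w → deg G w ℕ.≤ deg (complete n) w
  deg-≤-complete w = length-mono-≤
    (filter⁺ (λ x → adj G w x ≟B true) (λ x → Kadj w x ≟B true)
             (λ { refl → adj⇒Kadj }) (⊆-refl {x = allFin n}))

module _ {m : ℕ} where

  private
    K : SimpleGraph (suc (suc m))
    K = complete (suc (suc m))

    1<n : 1 ℕ.< suc (suc m)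
    1<n = s≤s (s≤s z≤n)

  reach-1-complete : ∀ u v → reach K 1 u v ≡ true
  reach-1-complete u v = from (u ≟ v)
    where
    from : Dec (u ≡ v) → reach K 1 u v ≡ true
    from (yes refl) = ∨-trueˡ _ (⌊≟⌋-refl u)
    from (no u≢v)   = adj⇒reach-1 K (≢⇒Kadj u≢v)

  ecc-complete : ∀ u → ecc K u ≡ 1
  ecc-complete u = ℕ.≤-antisym
    (foldr-preserves (ℕ._≤ 1) (λ v → ℕ.⊔-lub (dist-≤ K {u} {v} (reach-1-complete u v) 1<n))
                     z≤n (allFin _))
    (ℕ.≤-trans (≢⇒dist-pos K (punchInᵢ≢i u zero ∘ ≡-sym)) (∈⇒≤-foldr-⊔ (dist K u) (∈-allFin _)))

  deg-complete-pos : ∀ w → 1 ℕ.≤ deg K w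
  deg-complete-pos w = filter-some (λ x → Kadj w x ≟B true)
    (lose (∈-allFin (punchIn w zero)) (≢⇒Kadj (punchInᵢ≢i w zero ∘ ≡-sym)))

  M-complete-pos : ∀ u → 1 ℕ.≤ M K u
  M-complete-pos u = foldr-preserves (1 ℕ.≤_)
    (λ w → ℕ.*-mono-≤ (if-pos (Kadj u w) (deg-complete-pos w))) ℕ.≤-refl (allFin _)

  M-≤-complete : ∀ G u → M G u ℕ.≤ M K u
  M-≤-complete G u = foldr-mono ℕ._≤_
    (λ w → ℕ.*-mono-≤ (if-mono-≤ (adj⇒Kadj G) (deg-≤-complete G w) (deg-complete-pos w)))
    ℕ.≤-refl (allFin _)

  ecc-≤1⇒Kadj : ∀ G u → ecc G u ℕ.≤ 1 → ∀ v → adj G u v ≡ Kadj u v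
  ecc-≤1⇒Kadj G u ecc≤1 v =
    row (reach-1⇒≡⊎adj G (reach-mono G (ℕ.≤⇒≤′ dist≤1) (dist-reach G {u} {v} dist<n)))
    where
    dist≤1 : dist G u v ℕ.≤ 1
    dist≤1 = ℕ.≤-trans (∈⇒≤-foldr-⊔ (dist G u) (∈-allFin v)) ecc≤1
    dist<n : dist G u v ℕ.< suc (suc m)
    dist<n = ℕ.≤-<-trans dist≤1 1<n
    row : u ≡ v ⊎ adj G u v ≡ true → adj G u v ≡ Kadj u v
    row (inj₁ refl) = trans (irrefl G u) (≡-sym (irrefl K u))
    row (inj₂ Guv)  = trans Guv (≡-sym (adj⇒Kadj G Guv))

  term-≤-complete : ∀ G u → frac (M G u) (ecc G u) ≤ frac (M K u) (ecc K u)
  term-≤-complete G u rewrite ecc-complete u = frac-≤-whole (ecc G u) (M-≤-complete G u)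

  term-<-complete : ∀ G u → 2 ℕ.≤ ecc G u → frac (M G u) (ecc G u) < frac (M K u) (ecc K u)
  term-<-complete G u 2≤ecc rewrite ecc-complete u =
    frac-<-whole (M-≤-complete G u) (M-complete-pos u) 2≤ecc

proposition14 : (n : ℕ) → n ≥ 2 → (G : SimpleGraph n) → Connected G
    → ¬ (∀ u v → adj G u v ≡ Kadj u v)
    → ξac G < ξac (complete n)
proposition14 (suc (suc m)) _ G _ G≢K
  with ¬∀⟶∃¬ _ _ (λ u → all? (λ v → adj G u v ≟B Kadj u v)) G≢K
... | u , u-not-dominating =
  Σℚ-mono-< (term-≤-complete G) (lose (∈-allFin u) (term-<-complete G u 2≤ecc))
  where
  2≤ecc : 2 ℕ.≤ ecc G u
  2≤ecc = ℕ.≰⇒> (u-not-dominating ∘ ecc-≤1⇒Kadj G u)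
proposition14 (suc zero) (s≤s ())
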